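{- Let $H$ and $K$ be connected graphs such that $V(H)\cap V(K)=\{v\}$ and $v$ is a cut vertex of $G=H\cup K$. Let $\omega:E(G)\to\{1,2,3,\dots\}$ be a weight function, and assume there are integers $a,b$ with $\pi_t(K_\omega,v)=at+b$ for all positive integers $t$, where $K_\omega$ denotes $K$ with the restriction of $\omega$ to $E(K)$. Define the graph $\tilde G$ by $V(\tilde G)=V(H)\,\dot\cup\,\{u\}$ for a new vertex $u$ and $E(\tilde G)=E(H)\cup\{vu\}$, with weight function $\tilde\omega(vu)=a$ and $\tilde\omega(e)=\omega(e)$ for $e\in E(H)$. If $x\in V(H)$, then $\pi(G_\omega,x)=\pi(\tilde G_{\tilde\omega},x)+b$.
   Context: All graphs are finite, simple and connected; a weighted graph $G_\omega$ is a graph $G$ with a weight function $\omega:E(G)\to\{1,2,3,\dots\}$. A pebble distribution is a function $p:V(G)\to\mathbb{Z}_{\ge0}$, of size $\|p\|=\sum_{w}p(w)$. For $yz\in E(G)$, the pebbling move $(y\to z)$ removes $\omega(yz)$ pebbles from $y$ and adds one pebble at $z$. A sequence of moves is executable from $p$ if after each move all vertices have nonnegatively many pebbles. A vertex $x$ is $t$-reachable from $p$ if some sequence executable from $p$ results in at least $t$ pebbles on $x$. $\pi_t(G_\omega,x)$ is the minimum $m$ such that $x$ is $t$-reachable from every pebble distribution of size $m$, and $\pi(G_\omega,x)=\pi_1(G_\omega,x)$. -}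

module Defs where

open import Data.Nat using (ℕ; zero; suc; _+_; _∸_; _≤_; _<_)
open import Data.Fin using (Fin; zero; suc)
open import Data.Fin.Properties using (_≟_)
open import Data.Bool using (if_then_else_)
open import Data.Product using (Σ; ∃; _×_; _,_)
open import Data.Unit using (⊤)
open import Relation.Nullary using (¬_; does)
open import Relation.Binary.PropositionalEquality using (_≡_; _≢_)
open import Function using (_∘_)

-- A weighted simple graph on vertex set Fin n is encoded by a weight matrix
-- w : Fin n → Fin n → ℕ, where w i j = 0 means "ij is not an edge" and
-- w i j = ω(ij) ≥ 1 if ij is an edge. Symmetry / looplessness are separate
-- hypotheses (see Statement).
Weights : ℕ → Set
Weights n = Fin n → Fin n → ℕ

Edge : ∀ {n} → Weights n → Fin n → Fin n → Set
Edge w i j = 0 < w i j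

-- Vertex subsets as predicates; the subgraph on S is the induced one.
VSet : ℕ → Set₁
VSet n = Fin n → Set

data WalkIn {n} (w : Weights n) (S : VSet n) : Fin n → Fin n → Set where
  []  : ∀ {x} → WalkIn w S x x
  _∷_ : ∀ {x y z} → (S x × S y × Edge w x y) → WalkIn w S y z → WalkIn w S x z

ConnectedOn : ∀ {n} → Weights n → VSet n → Set
ConnectedOn w S = ∀ x y → S x → S y → WalkIn w S x y

AllV : ∀ {n} → VSet n
AllV _ = ⊤

CutVertex : ∀ {n} → Weights n → Fin n → Set
CutVertex w v = ¬ ConnectedOn w (λ i → i ≢ v)

Dist : ℕ → Set
Dist n = Fin n → ℕ

size : ∀ {n} → Dist n → ℕ
size {zero}  p = 0
size {suc n} p = p zero + size (p ∘ suc)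

Supported : ∀ {n} → VSet n → Dist n → Set
Supported S p = ∀ i → ¬ S i → p i ≡ 0

move : ∀ {n} → Weights n → Dist n → Fin n → Fin n → Dist n
move w p y z i =
  (p i ∸ (if does (i ≟ y) then w y z else 0)) + (if does (i ≟ z) then 1 else 0)

data Reach {n} (w : Weights n) (S : VSet n) : Dist n → Dist n → Set where
  done : ∀ {p} → Reach w S p p
  step : ∀ {p q} (y z : Fin n) → S y → S z → Edge w y z → w y z ≤ p y →
         Reach w S (move w p y z) q → Reach w S p q

TReachable : ∀ {n} → Weights n → VSet n → Dist n → Fin n → ℕ → Set
TReachable w S p x t = ∃ λ q → Reach w S p q × t ≤ q x

IsPebblingNumber : ∀ {n} → Weights n → VSet n → Fin n → ℕ → ℕ → Set
IsPebblingNumber w S x t m =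
  (∀ p → Supported S p → size p ≡ m → TReachable w S p x t) ×
  (∀ m′ → m′ < m → ∃ λ p → Supported S p × size p ≡ m′ × ¬ TReachable w S p x t)

-- The graph G̃: vertices Fin (suc n), new vertex u = zero, old vertex i = suc i.
-- Weights between old vertices are copied, the edge vu gets weight a,
-- u has no other neighbours.
tildeW : ∀ {n} → Weights n → Fin n → ℕ → Weights (suc n)
tildeW w v a zero    zero    = 0
tildeW w v a zero    (suc j) = if does (j ≟ v) then a else 0
tildeW w v a (suc i) zero    = if does (i ≟ v) then a else 0
tildeW w v a (suc i) (suc j) = w i j

tildeV : ∀ {n} → VSet n → VSet (suc n)
tildeV H zero    = ⊤
tildeV H (suc i) = H i

-- From π_t(K, v) = a t + b at t = 1, 2 and the elementary bounds π₁ < π₂ ≤ 2 π₁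
-- we get a ≥ 1 and b ≥ 0. Both inequalities between π(G, x) and π(G̃, x) + b are
-- then proved by simulation, the K-side of a distribution on G corresponding to
-- pebbles on u. A K-side with k pebbles can put ⌊(k − b)/a⌋ pebbles on v, as many
-- as k − b pebbles on u can, so every solution in G̃ lifts to G. Conversely, an
-- unsolvable distribution of G̃ with c pebbles on u, combined with a K-side of
-- size just below π_{⌊c/a⌋+1}(K, v), stays unsolvable in G: G̃ can replay the
-- moves of G, because the K-side can never bring more pebbles to v than u can
-- pay for at a pebbles each.

module Submission where

open import Defs
open import Data.Nat hiding (_≟_)
open import Data.Nat.Properties hiding (_≟_)
open import Data.Nat.DivMod using (_/_; _%_; m≡m%n+[m/n]*n; m%n<n; m/n*n≤m)
open import Data.Nat.Tactic.RingSolver using (solve-∀)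
open import Data.Fin using (Fin; zero; suc)
open import Data.Fin.Properties using (_≟_)
open import Data.Bool using (if_then_else_)
open import Data.Product using (∃; ∃₂; _×_; _,_; proj₁; proj₂)
open import Data.Sum using (_⊎_; inj₁; inj₂; [_,_]′)
open import Data.Unit using (tt)
open import Data.Empty using (⊥; ⊥-elim)
open import Relation.Nullary using (¬_; does; yes; no; contradiction)
open import Relation.Nullary.Decidable using (toSum)
open import Relation.Binary.PropositionalEquality
open import Function using (_∘_)
open import Data.Integer using (ℤ)
import Data.Integer as ℤ
import Data.Integer.Properties as ℤ
import Data.Integer.Tactic.RingSolver as ℤ-Solver

point : ∀ {n} → Fin n → ℕ → Dist n
point y k i = if does (i ≟ y) then k else 0

module _ {n} {y : Fin n} where

  point-≡ : ∀ {i} k → i ≡ y → point y k i ≡ k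
  point-≡ {i} k i≡y with i ≟ y
  ... | yes _  = refl
  ... | no i≢y = contradiction i≡y i≢y

  point-≢ : ∀ {i} k → i ≢ y → point y k i ≡ 0
  point-≢ {i} k i≢y with i ≟ y
  ... | yes i≡y = contradiction i≡y i≢y
  ... | no _    = refl

  point-≤ : ∀ i {k m} → (i ≡ y → k ≤ m) → point y k i ≤ m
  point-≤ i k≤m with i ≟ y
  ... | yes i≡y = k≤m i≡y
  ... | no _    = z≤n

  point-+ : ∀ i j k → point y (j + k) i ≡ point y j i + point y k i
  point-+ i j k with i ≟ y
  ... | yes _ = refl
  ... | no _  = refl

point-self : ∀ {n} (y : Fin n) k → point y k y ≡ k
point-self y k = point-≡ {y = y} k refl

point-0 : ∀ {n} (y i : Fin n) → point y 0 i ≡ 0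
point-0 y i = n≤0⇒n≡0 (point-≤ {y = y} i λ _ → ≤-refl)

module _ {n} (w : Weights n) (p : Dist n) {y z i : Fin n} where

  move-source : i ≡ y → move w p y z i ≡ (p i ∸ w y z) + point z 1 i
  move-source i≡y = cong (λ c → (p i ∸ c) + point z 1 i) (point-≡ (w y z) i≡y)

  move-off-source : i ≢ y → move w p y z i ≡ p i + point z 1 i
  move-off-source i≢y = cong (λ c → (p i ∸ c) + point z 1 i) (point-≢ (w y z) i≢y)

  move-untouched : i ≢ y → i ≢ z → move w p y z i ≡ p i
  move-untouched i≢y i≢z = begin
    move w p y z i      ≡⟨ move-off-source i≢y ⟩
    p i + point z 1 i   ≡⟨ cong (p i +_) (point-≢ 1 i≢z) ⟩
    p i + 0             ≡⟨ +-identityʳ (p i) ⟩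
    p i                 ∎
    where open ≡-Reasoning

  move-cong : ∀ {p′ : Dist n} → p i ≡ p′ i → move w p y z i ≡ move w p′ y z i
  move-cong eq = cong (λ a → (a ∸ point y (w y z) i) + point z 1 i) eq

  move-+-≤ : ∀ {p′ : Dist n} {d} → (i ≡ y → w y z ≤ p i) →
             p i + d ≤ p′ i → move w p y z i + d ≤ move w p′ y z i
  move-+-≤ {p′} {d} enough le = begin
    (p i ∸ c) + e + d    ≡⟨ +-assoc (p i ∸ c) e d ⟩
    (p i ∸ c) + (e + d)  ≡⟨ cong ((p i ∸ c) +_) (+-comm e d) ⟩
    (p i ∸ c) + (d + e)  ≡⟨ +-assoc (p i ∸ c) d e ⟨
    (p i ∸ c) + d + e    ≡⟨ cong (_+ e) (+-∸-comm d c≤p) ⟨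
    (p i + d ∸ c) + e    ≤⟨ +-monoˡ-≤ e (∸-monoˡ-≤ c le) ⟩
    (p′ i ∸ c) + e       ∎
    where
      open ≤-Reasoning
      c = point y (w y z) i
      e = point z 1 i
      c≤p : c ≤ p i
      c≤p = point-≤ i enough

  move-≤-+ : ∀ {p′ : Dist n} {d} → (i ≡ y → w y z ≤ p i) →
             p′ i ≤ p i + d → move w p′ y z i ≤ move w p y z i + d
  move-≤-+ {p′} {d} enough le = begin
    (p′ i ∸ c) + e       ≤⟨ +-monoˡ-≤ e (∸-monoˡ-≤ c le) ⟩
    (p i + d ∸ c) + e    ≡⟨ cong (_+ e) (+-∸-comm d c≤p) ⟩
    (p i ∸ c) + d + e    ≡⟨ +-assoc (p i ∸ c) d e ⟩
    (p i ∸ c) + (d + e)  ≡⟨ cong ((p i ∸ c) +_) (+-comm d e) ⟩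
    (p i ∸ c) + (e + d)  ≡⟨ +-assoc (p i ∸ c) e d ⟨
    (p i ∸ c) + e + d    ∎
    where
      open ≤-Reasoning
      c = point y (w y z) i
      e = point z 1 i
      c≤p : c ≤ p i
      c≤p = point-≤ i enough

-- Reachability

module _ {n} {w : Weights n} {S : VSet n} where

  Reach-⊆ : ∀ {S′ : VSet n} {p q} → (∀ i → S i → S′ i) → Reach w S p q → Reach w S′ p q
  Reach-⊆ S⊆S′ done                     = done
  Reach-⊆ S⊆S′ (step y z Sy Sz e ok R) = step y z (S⊆S′ y Sy) (S⊆S′ z Sz) e ok (Reach-⊆ S⊆S′ R)

  Reach-++ : ∀ {p q r} → Reach w S p q → Reach w S q r → Reach w S p r
  Reach-++ done                     R = R
  Reach-++ (step y z Sy Sz e ok R₁) R = step y z Sy Sz e ok (Reach-++ R₁ R)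

  TReachable-pre : ∀ {p q x t} → Reach w S p q → TReachable w S q x t → TReachable w S p x t
  TReachable-pre R (r , R′ , t≤r) = r , Reach-++ R R′ , t≤r

  Reach-surplus : ∀ {q r} (q′ d : Dist n) → (∀ i → S i → q i + d i ≤ q′ i) → Reach w S q r →
                  ∃ λ r′ → Reach w S q′ r′ × (∀ i → S i → r i + d i ≤ r′ i)
  Reach-surplus q′ d le done = q′ , done , le
  Reach-surplus {q} q′ d le (step y z Sy Sz e ok R)
    with Reach-surplus (move w q′ y z) d le′ R
    where
      le′ : ∀ i → S i → move w q y z i + d i ≤ move w q′ y z i
      le′ i Si = move-+-≤ w q {p′ = q′} (λ { refl → ok }) (le i Si)
  ... | r′ , R′ , le-r = r′ , step y z Sy Sz e ok′ R′ , le-r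
    where
      ok′ : w y z ≤ q′ y
      ok′ = ≤-trans ok (≤-trans (m≤m+n (q y) (d y)) (le y Sy))

  Reach-≤ : ∀ {q r} (q′ : Dist n) → (∀ i → S i → q i ≤ q′ i) → Reach w S q r →
            ∃ λ r′ → Reach w S q′ r′ × (∀ i → S i → r i ≤ r′ i)
  Reach-≤ {q} q′ le R with Reach-surplus q′ (λ _ → 0) (λ i Si → ≤-trans (≤-reflexive (+-identityʳ (q i))) (le i Si)) R
  ... | r′ , R′ , le-r = r′ , R′ , λ i Si → ≤-trans (≤-reflexive (sym (+-identityʳ _))) (le-r i Si)

  -- A move that the poorer distribution cannot afford must start at the vertex
  -- holding the missing pebble, and then the deficit passes on to the target.
  Reach-deficit-one : ∀ {q′ r} (q : Dist n) (y₀ x : Fin n) → S x →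
                      (∀ i → S i → q′ i ≤ q i + point y₀ 1 i) → Reach w S q′ r →
                      ∃ λ r′ → Reach w S q r′ × r x ≤ r′ x + 1
  Reach-deficit-one q y₀ x Sx le done =
    q , done , ≤-trans (le x Sx) (+-monoʳ-≤ (q x) (point-≤ x (λ _ → ≤-refl)))
  Reach-deficit-one {q′} q y₀ x Sx le (step y z Sy Sz e ok R) with w y z ≤? q y
  ... | yes ok′ with Reach-deficit-one (move w q y z) y₀ x Sx le′ R
    where
      le′ : ∀ i → S i → move w q′ y z i ≤ move w q y z i + point y₀ 1 i
      le′ i Si = move-≤-+ w q {p′ = q′} (λ { refl → ok′ }) (le i Si)
  ... | r′ , R′ , le-r = r′ , step y z Sy Sz e ok′ R′ , le-r
  Reach-deficit-one {q′} q y₀ x Sx le (step y z Sy Sz e ok R) | no ¬ok =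
    Reach-deficit-one q z x Sx le′ R
    where
      y≡y₀ : y ≡ y₀
      y≡y₀ with y ≟ y₀
      ... | yes eq = eq
      ... | no y≢y₀ = contradiction (≤-trans ok (≤-trans (le y Sy)
                        (≤-reflexive (trans (cong (q y +_) (point-≢ 1 y≢y₀)) (+-identityʳ (q y)))))) ¬ok
      le′ : ∀ i → S i → move w q′ y z i ≤ q i + point z 1 i
      le′ i Si with i ≟ y
      ... | yes refl = begin
        (q′ i ∸ w i z) + point z 1 i  ≡⟨ cong (_+ point z 1 i) (m≤n⇒m∸n≡0 q′≤w) ⟩
        point z 1 i                   ≤⟨ m≤n+m _ (q i) ⟩
        q i + point z 1 i             ∎
        where
          open ≤-Reasoning
          q′≤w : q′ i ≤ w i z
          q′≤w = ≤-trans (le i Si) (≤-trans (≤-reflexive (trans (cong (q i +_) (point-≡ 1 y≡y₀)) (+-comm (q i) 1))) (≰⇒> ¬ok))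
      ... | no i≢y = +-monoˡ-≤ (point z 1 i) (≤-trans (le i Si)
                       (≤-reflexive (trans (cong (q i +_) (point-≢ 1 (λ i≡y₀ → i≢y (trans i≡y₀ (sym y≡y₀))))) (+-identityʳ (q i)))))

  Reach-deficit : ∀ {q′ r} (k : ℕ) (q : Dist n) (y₀ x : Fin n) → S x →
                  (∀ i → S i → q′ i ≤ q i + point y₀ k i) → Reach w S q′ r →
                  ∃ λ r′ → Reach w S q r′ × r x ≤ r′ x + k
  Reach-deficit zero q y₀ x Sx le R with Reach-≤ q le′ R
    where
      le′ : ∀ i → S i → _ ≤ q i
      le′ i Si = ≤-trans (le i Si) (≤-reflexive (trans (cong (q i +_) (point-0 y₀ i)) (+-identityʳ (q i))))
  ... | r′ , R′ , le-r = r′ , R′ , ≤-trans (le-r x Sx) (m≤m+n (r′ x) 0)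
  Reach-deficit (suc k) q y₀ x Sx le R
    with Reach-deficit-one (λ i → q i + point y₀ k i) y₀ x Sx le′ R
    where
      le′ : ∀ i → S i → _ ≤ q i + point y₀ k i + point y₀ 1 i
      le′ i Si = ≤-trans (le i Si) (≤-reflexive (trans (cong (q i +_) (trans (cong (λ k → point y₀ k i) (+-comm 1 k)) (point-+ i k 1)))
                   (sym (+-assoc (q i) _ _))))
  ... | r₁ , R₁ , le₁ with Reach-deficit k q y₀ x Sx (λ i Si → ≤-refl) R₁
  ... | r′ , R′ , r₁≤ = r′ , R′ , ≤-trans le₁ (≤-trans (+-monoˡ-≤ 1 r₁≤)
                          (≤-reflexive (trans (+-assoc (r′ x) k 1) (cong (r′ x +_) (+-comm k 1)))))

size-cong : ∀ {n} {f g : Dist n} → (∀ i → f i ≡ g i) → size f ≡ size g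
size-cong {zero}  eq = refl
size-cong {suc n} eq = cong₂ _+_ (eq zero) (size-cong (eq ∘ suc))

size-+ : ∀ {n} (f g : Dist n) → size (λ i → f i + g i) ≡ size f + size g
size-+ {zero}  f g = refl
size-+ {suc n} f g = trans (cong (f zero + g zero +_) (size-+ (f ∘ suc) (g ∘ suc)))
                           (interchange (f zero) (g zero) _ _)
  where
    interchange : ∀ a b c d → (a + b) + (c + d) ≡ (a + c) + (b + d)
    interchange = solve-∀

size-zeros : ∀ {n} → size {n} (λ _ → 0) ≡ 0
size-zeros {zero}  = refl
size-zeros {suc n} = size-zeros {n}

size-point : ∀ {n} (y : Fin n) k → size (point y k) ≡ k
size-point {suc n} zero    k = trans (cong (k +_) (size-zeros {n})) (+-identityʳ k)
size-point {suc n} (suc y) k = size-point y k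

sub-distribution : ∀ {n} (p : Dist n) m → m ≤ size p →
                   ∃ λ p₁ → (∀ i → p₁ i ≤ p i) × size p₁ ≡ m
sub-distribution {zero}  p zero z≤n = p , (λ ()) , refl
sub-distribution {suc n} p m m≤ with m ≤? size (p ∘ suc)
... | yes m≤tail with sub-distribution (p ∘ suc) m m≤tail
...   | p₁ , p₁≤ , size-p₁ = (λ { zero → 0 ; (suc i) → p₁ i }) , (λ { zero → z≤n ; (suc i) → p₁≤ i }) , size-p₁
sub-distribution {suc n} p m m≤ | no m≰tail =
  (λ { zero → m ∸ size (p ∘ suc) ; (suc i) → p (suc i) }) ,
  (λ { zero → m≤n+o⇒m∸n≤o m _ (subst (m ≤_) (+-comm (p zero) _) m≤) ; (suc i) → ≤-refl }) ,
  m∸n+n≡m (<⇒≤ (≰⇒> m≰tail))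

Supported-≤ : ∀ {n} {S : VSet n} {p q : Dist n} → (∀ i → q i ≤ p i) → Supported S p → Supported S q
Supported-≤ q≤p supp-p i ¬Si = n≤0⇒n≡0 (subst (_ ≤_) (supp-p i ¬Si) (q≤p i))

module _ {n} {w : Weights n} {S : VSet n} where

  ¬TReachable-zeros : ∀ {x} → ¬ TReachable w S (λ _ → 0) x 1
  ¬TReachable-zeros (q , done , ()) 
  ¬TReachable-zeros (q , step y z Sy Sz e ok R , _) = <⇒≱ e ok

  TReachable-≥-size : ∀ {x t m} → S x →
                      (∀ p → Supported S p → size p ≡ m → TReachable w S p x t) →
                      ∀ p → Supported S p → m ≤ size p → TReachable w S p x t
  TReachable-≥-size {x} Sx reach-m p supp-p m≤ with sub-distribution p _ m≤
  ... | p₁ , p₁≤p , size-p₁ with reach-m p₁ (Supported-≤ p₁≤p supp-p) size-p₁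
  ... | q , R , t≤q with Reach-≤ p (λ i _ → p₁≤p i) R
  ... | r , R′ , q≤r = r , R′ , ≤-trans t≤q (q≤r x Sx)

-- Pebbling numbers of a single vertex

module _ {n} {w : Weights n} {S : VSet n} {x : Fin n} where

  IsPebblingNumber-positive : ∀ {m} → IsPebblingNumber w S x 1 m → 1 ≤ m
  IsPebblingNumber-positive {zero}  (reach , _) =
    contradiction (reach (λ _ → 0) (λ _ _ → refl) (size-zeros {n})) ¬TReachable-zeros
  IsPebblingNumber-positive {suc m} _ = s≤s z≤n

  -- An unsolvable distribution of size π₁ − 1 plus one pebble on x still
  -- cannot put two pebbles on x.
  π₁<π₂ : ∀ {m₁ m₂} → S x → IsPebblingNumber w S x 1 m₁ → IsPebblingNumber w S x 2 m₂ → m₁ < m₂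
  π₁<π₂ {zero}  Sx π₁ π₂ = contradiction (IsPebblingNumber-positive π₁) λ ()
  π₁<π₂ {suc m} {m₂} Sx π₁ π₂ = ≰⇒> m₂≰
    where
      m₂≰ : ¬ m₂ ≤ suc m
      m₂≰ m₂≤ with proj₂ π₁ m ≤-refl
      ... | p , supp-p , size-p , ¬reach with TReachable-≥-size Sx (proj₁ π₂) p⁺ supp-p⁺ (subst (m₂ ≤_) (sym size-p⁺) m₂≤)
        where
          p⁺ : Dist n
          p⁺ i = p i + point x 1 i
          supp-p⁺ : Supported S p⁺
          supp-p⁺ i ¬Si = cong₂ _+_ (supp-p i ¬Si) (point-≢ {y = x} {i} 1 λ { refl → ¬Si Sx })
          size-p⁺ : size p⁺ ≡ suc m
          size-p⁺ = trans (size-+ p (point x 1)) (trans (cong₂ _+_ size-p (size-point x 1)) (+-comm m 1))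
      ... | r , R , 2≤r with Reach-deficit-one p x x Sx (λ i _ → ≤-refl) R
      ... | r′ , R′ , r≤r′+1 = ¬reach (r′ , R′ , +-cancelʳ-≤ 1 1 (r′ x) (≤-trans 2≤r r≤r′+1))

  π₂≤π₁+π₁ : ∀ {m₁ m₂} → S x → IsPebblingNumber w S x 1 m₁ → IsPebblingNumber w S x 2 m₂ → m₂ ≤ m₁ + m₁
  π₂≤π₁+π₁ {m₁} {m₂} Sx π₁ π₂ = ≮⇒≥ ¬<
    where
      ¬< : ¬ m₁ + m₁ < m₂
      ¬< lt with proj₂ π₂ (m₁ + m₁) lt
      ... | p , supp-p , size-p , ¬reach with sub-distribution p m₁ (≤-trans (m≤m+n m₁ m₁) (≤-reflexive (sym size-p)))
      ... | p₁ , p₁≤p , size-p₁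
        with proj₁ π₁ p₁ (Supported-≤ p₁≤p supp-p) size-p₁
           | proj₁ π₁ p₂ (Supported-≤ (λ i → m∸n≤m (p i) (p₁ i)) supp-p) size-p₂
        where
          p₂ : Dist n
          p₂ i = p i ∸ p₁ i
          size-p₂ : size p₂ ≡ m₁
          size-p₂ = +-cancelˡ-≡ m₁ _ _ (begin
            m₁ + size p₂          ≡⟨ cong (_+ size p₂) size-p₁ ⟨
            size p₁ + size p₂     ≡⟨ size-+ p₁ p₂ ⟨
            size (λ i → p₁ i + p₂ i) ≡⟨ size-cong (λ i → m+[n∸m]≡n (p₁≤p i)) ⟩
            size p                ≡⟨ size-p ⟩
            m₁ + m₁               ∎)
            where open ≡-Reasoning
      ... | r₁ , R₁ , 1≤r₁ | r₂ , R₂ , 1≤r₂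
        with Reach-surplus p (λ i → p i ∸ p₁ i) (λ i _ → ≤-reflexive (m+[n∸m]≡n (p₁≤p i))) R₁
      ... | s , R , s≥ with Reach-surplus s r₁ (λ i Si → ≤-trans (≤-reflexive (+-comm _ (r₁ i))) (s≥ i Si)) R₂
      ... | s′ , R′ , s′≥ = ¬reach (s′ , Reach-++ R R′ , ≤-trans (+-mono-≤ 1≤r₂ 1≤r₁) (s′≥ x Sx))

  pebbling-coefficients : ∀ {m₁ m₂} (a b : ℤ) → S x →
                          IsPebblingNumber w S x 1 m₁ → IsPebblingNumber w S x 2 m₂ →
                          ℤ.+ m₁ ≡ a ℤ.* ℤ.+ 1 ℤ.+ b → ℤ.+ m₂ ≡ a ℤ.* ℤ.+ 2 ℤ.+ b →
                          ∃₂ λ A′ B → a ≡ ℤ.+ suc A′ × b ≡ ℤ.+ B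
  pebbling-coefficients {m₁} {m₂} a b Sx π₁ π₂ eq₁ eq₂ =
    pred (m₂ ∸ m₁) , (m₁ + m₁) ∸ m₂ , a≡ , b≡
    where
      m₁<m₂ = π₁<π₂ Sx π₁ π₂
      a≡ : a ≡ ℤ.+ suc (pred (m₂ ∸ m₁))
      a≡ = begin
        a                                          ≡⟨ a-as-difference a b ⟩
        (a ℤ.* ℤ.+ 2 ℤ.+ b) ℤ.- (a ℤ.* ℤ.+ 1 ℤ.+ b) ≡⟨ cong₂ ℤ._-_ eq₂ eq₁ ⟨
        ℤ.+ m₂ ℤ.- ℤ.+ m₁                           ≡⟨ ℤ.m-n≡m⊖n m₂ m₁ ⟩
        m₂ ℤ.⊖ m₁                                   ≡⟨ ℤ.⊖-≥ (<⇒≤ m₁<m₂) ⟩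
        ℤ.+ (m₂ ∸ m₁)                               ≡⟨ cong ℤ.+_ (suc-pred (m₂ ∸ m₁) {{>-nonZero (m<n⇒0<n∸m m₁<m₂)}}) ⟨
        ℤ.+ suc (pred (m₂ ∸ m₁))                    ∎
        where
          open ≡-Reasoning
          a-as-difference : ∀ a b → a ≡ (a ℤ.* ℤ.+ 2 ℤ.+ b) ℤ.- (a ℤ.* ℤ.+ 1 ℤ.+ b)
          a-as-difference = ℤ-Solver.solve-∀
      b≡ : b ≡ ℤ.+ ((m₁ + m₁) ∸ m₂)
      b≡ = begin
        b                                    ≡⟨ b-as-difference a b ⟩
        (a ℤ.* ℤ.+ 1 ℤ.+ b) ℤ.+ (a ℤ.* ℤ.+ 1 ℤ.+ b) ℤ.- (a ℤ.* ℤ.+ 2 ℤ.+ b)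
                                             ≡⟨ cong₂ (λ c d → c ℤ.+ c ℤ.- d) eq₁ eq₂ ⟨
        ℤ.+ m₁ ℤ.+ ℤ.+ m₁ ℤ.- ℤ.+ m₂           ≡⟨ cong (ℤ._- ℤ.+ m₂) (ℤ.pos-+ m₁ m₁) ⟨
        ℤ.+ (m₁ + m₁) ℤ.- ℤ.+ m₂               ≡⟨ ℤ.m-n≡m⊖n (m₁ + m₁) m₂ ⟩
        (m₁ + m₁) ℤ.⊖ m₂                       ≡⟨ ℤ.⊖-≥ (π₂≤π₁+π₁ Sx π₁ π₂) ⟩
        ℤ.+ ((m₁ + m₁) ∸ m₂)                   ∎
        where
          open ≡-Reasoning
          b-as-difference : ∀ a b → b ≡ (a ℤ.* ℤ.+ 1 ℤ.+ b) ℤ.+ (a ℤ.* ℤ.+ 1 ℤ.+ b) ℤ.- (a ℤ.* ℤ.+ 2 ℤ.+ b)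
          b-as-difference = ℤ-Solver.solve-∀

m<[1+m/n]*n : ∀ m n .{{_ : NonZero n}} → m < suc (m / n) * n
m<[1+m/n]*n m n = begin-strict
  m                    ≡⟨ m≡m%n+[m/n]*n m n ⟩
  m % n + (m / n) * n  <⟨ +-monoˡ-< ((m / n) * n) (m%n<n m n) ⟩
  n + (m / n) * n      ∎
  where open ≤-Reasoning

m∸o<n : ∀ {m n o} → 1 ≤ n → m < n + o → m ∸ o < n
m∸o<n {m} {n} {o} 1≤n m<n+o with o ≤? m
... | yes o≤m = +-cancelʳ-< o (m ∸ o) n (subst (_< n + o) (sym (m∸n+n≡m o≤m)) m<n+o)
... | no o≰m  = subst (_< n) (sym (m≤n⇒m∸n≡0 (<⇒≤ (≰⇒> o≰m)))) 1≤n

-- Gluing along the cut vertex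

module Gluing {n} (w : Weights n) (loopless : ∀ i → w i i ≡ 0)
  (H K : VSet n) (v : Fin n) (cover : ∀ i → H i ⊎ K i) (Hv : H v) (Kv : K v)
  (H∩K⊆v : ∀ i → H i → K i → i ≡ v)
  (edge-side : ∀ i j → Edge w i j → (H i × H j) ⊎ (K i × K j))
  (A′ : ℕ) where

  A : ℕ
  A = suc A′

  W̃ : Weights (suc n)
  W̃ = tildeW w v A

  H̃ : VSet (suc n)
  H̃ = tildeV H

  H-apart-K∖v : ∀ {i j} → H i → K j → j ≢ v → i ≢ j
  H-apart-K∖v Hi Kj j≢v refl = j≢v (H∩K⊆v _ Hi Kj)

  W̃-uv : W̃ zero (suc v) ≡ A
  W̃-uv = point-self v A

  edge-uv : Edge W̃ zero (suc v)
  edge-uv = subst (0 <_) (sym W̃-uv) (s≤s z≤n)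

  edge-u⇒v : ∀ {j} → Edge W̃ zero (suc j) → j ≡ v
  edge-u⇒v {j} e with j ≟ v
  ... | yes j≡v = j≡v
  edge-u⇒v {j} () | no _

  u→v-at-u : ∀ (t̃ : Dist (suc n)) → move W̃ t̃ zero (suc v) zero ≡ t̃ zero ∸ A
  u→v-at-u t̃ = trans (+-identityʳ _) (cong (t̃ zero ∸_) W̃-uv)

  v→u-at-v : ∀ (t̃ : Dist (suc n)) → move W̃ t̃ (suc v) zero (suc v) ≡ t̃ (suc v) ∸ A
  v→u-at-v t̃ = trans (+-identityʳ _) (cong (t̃ (suc v) ∸_) (trans (point-self v _) W̃-uv))

  move-v→u-≤ : ∀ {t̃ : Dist (suc n)} {s : Dist n} {f} → A ≤ t̃ (suc v) → (∀ i → t̃ (suc i) + point v f i ≤ s i) →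
               ∀ k → move W̃ t̃ (suc v) zero (suc k) + point v (suc f) k ≤ s k
  move-v→u-≤ {t̃} {s} {f} A≤ ≤s k = [ (λ { refl → at-v }) , off-v ]′ (toSum (k ≟ v))
    where
      open ≤-Reasoning
      at-v : move W̃ t̃ (suc v) zero (suc v) + point v (suc f) v ≤ s v
      at-v = begin
        move W̃ t̃ (suc v) zero (suc v) + point v (suc f) v ≡⟨ cong₂ _+_ (v→u-at-v t̃) (point-self v (suc f)) ⟩
        (t̃ (suc v) ∸ A) + suc f                          ≡⟨ +-suc _ f ⟩
        suc (t̃ (suc v) ∸ A) + f                          ≤⟨ +-monoˡ-≤ f (∸-monoʳ-< {o = 0} (s≤s z≤n) A≤) ⟩
        t̃ (suc v) + f                                    ≡⟨ cong (t̃ (suc v) +_) (point-self v f) ⟨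
        t̃ (suc v) + point v f v                          ≤⟨ ≤s v ⟩
        s v                                              ∎
      off-v : k ≢ v → move W̃ t̃ (suc v) zero (suc k) + point v (suc f) k ≤ s k
      off-v k≢v = begin
        move W̃ t̃ (suc v) zero (suc k) + point v (suc f) k ≡⟨ cong₂ _+_ (move-untouched W̃ t̃ {y = suc v} {z = zero} (λ { refl → k≢v refl }) λ ()) (point-≢ (suc f) k≢v) ⟩
        t̃ (suc k) + 0                                    ≡⟨ cong (t̃ (suc k) +_) (point-≢ f k≢v) ⟨
        t̃ (suc k) + point v f k                          ≤⟨ ≤s k ⟩
        s k                                              ∎

  -- G replays G̃ while holding, besides the pebbles of t̃ on V(H), f extra
  -- pebbles on v that stand in for the fewer than (f+1)A pebbles on u.
  simulate-in-G : ∀ {t̃ r̃ : Dist (suc n)} (s : Dist n) f x →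
        (∀ i → t̃ (suc i) + point v f i ≤ s i) → t̃ zero < suc f * A →
        Reach W̃ H̃ t̃ r̃ → 1 ≤ r̃ (suc x) → TReachable w AllV s x 1
  simulate-in-G s f x ≤s u< done 1≤ = s , done , ≤-trans 1≤ (≤-trans (m≤m+n _ _) (≤s x))
  simulate-in-G s f x ≤s u< (step zero zero _ _ () _ _) 1≤
  simulate-in-G s f x ≤s u< (step zero (suc j) _ _ e ok R) 1≤ with edge-u⇒v {j} e
  simulate-in-G {t̃} s zero x ≤s u< (step zero (suc j) _ _ e ok R) 1≤ | refl =
    contradiction (subst (_≤ t̃ zero) W̃-uv ok) (<⇒≱ (subst (t̃ zero <_) (+-identityʳ A) u<))
  simulate-in-G {t̃} s (suc f) x ≤s u< (step zero (suc j) _ _ e ok R) 1≤ | refl = simulate-in-G s f x ≤s′ u<′ R 1≤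
    where
      ≤s′ : ∀ i → t̃ (suc i) + point v 1 i + point v f i ≤ s i
      ≤s′ i = ≤-trans (≤-reflexive (trans (+-assoc (t̃ (suc i)) _ _) (cong (t̃ (suc i) +_) (sym (point-+ i 1 f))))) (≤s i)
      u<′ : move W̃ t̃ zero (suc v) zero < suc f * A
      u<′ = subst (_< suc f * A) (sym (u→v-at-u t̃))
              (+-cancelˡ-< A _ _ (subst (_< A + suc f * A) (sym (m+[n∸m]≡n (subst (_≤ t̃ zero) W̃-uv ok))) u<))
  simulate-in-G s f x ≤s u< (step (suc i) zero _ _ e ok R) 1≤ with edge-u⇒v {i} e
  simulate-in-G {t̃} s f x ≤s u< (step (suc i) zero _ _ e ok R) 1≤ | refl =
    simulate-in-G s (suc f) x (move-v→u-≤ {t̃} (subst (_≤ t̃ (suc v)) W̃-uv ok) ≤s) u<′ R 1≤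
    where
      u<′ : t̃ zero + 1 < suc (suc f) * A
      u<′ = subst (_< suc (suc f) * A) (+-comm 1 (t̃ zero)) (+-mono-≤-< (s≤s z≤n) u<)
  simulate-in-G {t̃} s f x ≤s u< (step (suc i) (suc j) _ _ e ok R) 1≤ =
    TReachable-pre (step i j tt tt e ok′ done) (simulate-in-G (move w s i j) f x ≤s′ u<′ R 1≤)
    where
      ok′ : w i j ≤ s i
      ok′ = ≤-trans ok (≤-trans (m≤m+n _ _) (≤s i))
      ≤s′ : ∀ k → move w (t̃ ∘ suc) i j k + point v f k ≤ move w s i j k
      ≤s′ k = move-+-≤ w (t̃ ∘ suc) {p′ = s} (λ { refl → ok }) (≤s k)
      u<′ : t̃ zero + 0 < suc f * A
      u<′ = subst (_< suc f * A) (sym (+-identityʳ (t̃ zero))) u<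

  Pushed : ℕ → Dist (suc n) → Set
  Pushed k t̃ = ∃ λ t̃′ → Reach W̃ H̃ t̃ t̃′ × t̃ zero ≤ t̃′ zero + k * A ×
                        (∀ i → t̃ (suc i) + point v k i ≤ t̃′ (suc i))

  push-u→v : ∀ k (t̃ : Dist (suc n)) → k * A ≤ t̃ zero → Pushed k t̃
  push-u→v zero t̃ _ =
    t̃ , done , m≤m+n _ 0 , λ i → ≤-reflexive (trans (cong (t̃ (suc i) +_) (point-0 v i)) (+-identityʳ _))
  push-u→v (suc k) t̃ A+kA≤ = extend (push-u→v k (move W̃ t̃ zero (suc v)) kA≤)
    where
      A≤ : A ≤ t̃ zero
      A≤ = ≤-trans (m≤m+n A (k * A)) A+kA≤
      kA≤ : k * A ≤ move W̃ t̃ zero (suc v) zero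
      kA≤ = subst (k * A ≤_) (sym (u→v-at-u t̃))
              (subst (_≤ t̃ zero ∸ A) (m+n∸m≡n A (k * A)) (∸-monoˡ-≤ A A+kA≤))
      extend : Pushed k (move W̃ t̃ zero (suc v)) → Pushed (suc k) t̃
      extend (t̃′ , R , u≤ , old≤) =
        t̃′ , step zero (suc v) tt Hv edge-uv (subst (_≤ t̃ zero) (sym W̃-uv) A≤) R , u≤′ , old≤′
        where
          u≤′ : t̃ zero ≤ t̃′ zero + suc k * A
          u≤′ = begin
            t̃ zero                          ≡⟨ m+[n∸m]≡n A≤ ⟨
            A + (t̃ zero ∸ A)                ≡⟨ cong (A +_) (u→v-at-u t̃) ⟨
            A + move W̃ t̃ zero (suc v) zero  ≤⟨ +-monoʳ-≤ A u≤ ⟩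
            A + (t̃′ zero + k * A)           ≡⟨ +-swap-left A (t̃′ zero) (k * A) ⟩
            t̃′ zero + (A + k * A)           ∎
            where
              open ≤-Reasoning
              +-swap-left : ∀ a b c → a + (b + c) ≡ b + (a + c)
              +-swap-left = solve-∀
          old≤′ : ∀ i → t̃ (suc i) + point v (suc k) i ≤ t̃′ (suc i)
          old≤′ i = ≤-trans (≤-reflexive (trans (cong (t̃ (suc i) +_) (point-+ i 1 k)) (sym (+-assoc (t̃ (suc i)) _ _)))) (old≤ i)

  _[v]≔_ : Dist n → ℕ → Dist n
  (s [v]≔ j) i = if does (i ≟ v) then j else s i

  [v]≔-at-v : ∀ s j {i} → i ≡ v → (s [v]≔ j) i ≡ j
  [v]≔-at-v s j {i} i≡v with i ≟ v
  ... | yes _   = refl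
  ... | no i≢v  = contradiction i≡v i≢v

  [v]≔-off-v : ∀ s j {i} → i ≢ v → (s [v]≔ j) i ≡ s i
  [v]≔-off-v s j {i} i≢v with i ≟ v
  ... | yes i≡v = contradiction i≡v i≢v
  ... | no _    = refl

  -- While G̃ replays G, c is e·A plus the pebbles on u, where e
  -- counts the pebbles G̃ keeps on v in reserve.
  Capped : Dist n → ℕ → Set
  Capped s c = ∀ j r → Reach w K (s [v]≔ j) r → r v * A ≤ j * A + c

  Capped-weaken : ∀ {s c c′} → c ≤ c′ → Capped s c → Capped s c′
  Capped-weaken c≤c′ cap j r R = ≤-trans (cap j r R) (+-monoʳ-≤ (j * A) c≤c′)

  Capped-≤ : ∀ {s s′ c} → (∀ i → K i → i ≢ v → s′ i ≤ s i) → Capped s c → Capped s′ c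
  Capped-≤ {s} {s′} s′≤s cap j r R with Reach-≤ (s [v]≔ j) ≤-[v]≔ R
    where
      ≤-[v]≔ : ∀ i → K i → (s′ [v]≔ j) i ≤ (s [v]≔ j) i
      ≤-[v]≔ i Ki = [ (λ i≡v → ≤-reflexive (trans ([v]≔-at-v s′ j i≡v) (sym ([v]≔-at-v s j i≡v))))
                    , (λ i≢v → subst₂ _≤_ (sym ([v]≔-off-v s′ j i≢v)) (sym ([v]≔-off-v s j i≢v)) (s′≤s i Ki i≢v)) ]′
                      (toSum (i ≟ v))
  ... | r′ , R′ , r≤r′ = ≤-trans (*-monoˡ-≤ A (r≤r′ v Kv)) (cap j r′ R′)

  -- Starting from j pebbles on v instead of q v costs or gains exactly |j − q v|
  -- pebbles on v.
  Capped-intro : ∀ {q c} → (∀ r → Reach w K q r → r v * A ≤ q v * A + c) → Capped q c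
  Capped-intro {q} {c} bound j r R with j ≤? q v
  ... | yes j≤qv with Reach-surplus q (point v (q v ∸ j)) surplus R
    where
      surplus : ∀ i → K i → (q [v]≔ j) i + point v (q v ∸ j) i ≤ q i
      surplus i Ki = [ (λ { refl → ≤-reflexive (trans (cong₂ _+_ ([v]≔-at-v q j refl) (point-self v _)) (m+[n∸m]≡n j≤qv)) })
                     , (λ i≢v → ≤-reflexive (trans (cong₂ _+_ ([v]≔-off-v q j i≢v) (point-≢ _ i≢v)) (+-identityʳ (q i)))) ]′
                       (toSum (i ≟ v))
  ...   | r′ , R′ , r≤r′ = cancel (r v) j (q v ∸ j) c (begin
    (r v + (q v ∸ j)) * A  ≤⟨ *-monoˡ-≤ A (subst (λ d → r v + d ≤ r′ v) (point-self v _) (r≤r′ v Kv)) ⟩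
    r′ v * A               ≤⟨ bound r′ R′ ⟩
    q v * A + c            ≡⟨ cong (λ m → m * A + c) (m+[n∸m]≡n j≤qv) ⟨
    (j + (q v ∸ j)) * A + c ∎)
    where
      open ≤-Reasoning
      cancel : ∀ r j d c → (r + d) * A ≤ (j + d) * A + c → r * A ≤ j * A + c
      cancel r j d c le = +-cancelʳ-≤ (d * A) (r * A) (j * A + c)
        (≤-trans (≤-reflexive (sym (*-distribʳ-+ A r d))) (≤-trans le (≤-reflexive (rearrange j d c A))))
        where
          rearrange : ∀ j d c A → (j + d) * A + c ≡ j * A + c + d * A
          rearrange = solve-∀
  Capped-intro {q} {c} bound j r R | no j≰qv with Reach-deficit (j ∸ q v) q v v Kv deficit R
    where
      deficit : ∀ i → K i → (q [v]≔ j) i ≤ q i + point v (j ∸ q v) i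
      deficit i Ki = [ (λ { refl → subst₂ _≤_ (sym ([v]≔-at-v q j refl)) (cong (q v +_) (sym (point-self v _))) (m≤n+m∸n j (q v)) })
                     , (λ i≢v → ≤-reflexive (trans ([v]≔-off-v q j i≢v) (sym (trans (cong (q i +_) (point-≢ _ i≢v)) (+-identityʳ (q i)))))) ]′
                       (toSum (i ≟ v))
  ... | r′ , R′ , r≤r′+d = begin
    r v * A                      ≤⟨ *-monoˡ-≤ A r≤r′+d ⟩
    (r′ v + d) * A               ≡⟨ *-distribʳ-+ A (r′ v) d ⟩
    r′ v * A + d * A             ≤⟨ +-monoˡ-≤ (d * A) (bound r′ R′) ⟩
    q v * A + c + d * A          ≡⟨ rearrange (q v) d c A ⟩
    (q v + d) * A + c            ≡⟨ cong (λ m → m * A + c) (m+[n∸m]≡n (<⇒≤ (≰⇒> j≰qv))) ⟩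
    j * A + c                    ∎
    where
      open ≤-Reasoning
      d = j ∸ q v
      rearrange : ∀ q d c A → q * A + c + d * A ≡ (q + d) * A + c
      rearrange = solve-∀

  Capped-K-move : ∀ {s c y z} → K y → K z → Edge w y z → y ≢ v → w y z ≤ s y → Capped s c →
                  ∀ j r → Reach w K (move w s y z [v]≔ j) r → (r v + point z 1 v) * A ≤ j * A + c
  Capped-K-move {s} {c} {y} {z} Ky Kz e y≢v ok cap j r R
    with Reach-surplus (move w (s [v]≔ j) y z) (point v (point z 1 v)) carried R
    where
      carried : ∀ i → K i → (move w s y z [v]≔ j) i + point v (point z 1 v) i ≤ move w (s [v]≔ j) y z i
      carried i Ki = ≤-reflexive ([ (λ { refl → at-v }) , off-v ]′ (toSum (i ≟ v)))
        where
          at-v : (move w s y z [v]≔ j) v + point v (point z 1 v) v ≡ move w (s [v]≔ j) y z v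
          at-v = begin
            (move w s y z [v]≔ j) v + point v (point z 1 v) v ≡⟨ cong₂ _+_ ([v]≔-at-v (move w s y z) j refl) (point-self v _) ⟩
            j + point z 1 v                                   ≡⟨ cong (_+ point z 1 v) ([v]≔-at-v s j refl) ⟨
            (s [v]≔ j) v + point z 1 v                        ≡⟨ move-off-source w (s [v]≔ j) (λ v≡y → y≢v (sym v≡y)) ⟨
            move w (s [v]≔ j) y z v                           ∎
            where open ≡-Reasoning
          off-v : i ≢ v → (move w s y z [v]≔ j) i + point v (point z 1 v) i ≡ move w (s [v]≔ j) y z i
          off-v i≢v = trans (cong₂ _+_ ([v]≔-off-v (move w s y z) j i≢v) (point-≢ _ i≢v))
                        (trans (+-identityʳ _) (move-cong w s {y} {z} {i} {p′ = s [v]≔ j} (sym ([v]≔-off-v s j i≢v))))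
  ... | r′ , R′ , r≤r′ = ≤-trans (*-monoˡ-≤ A (subst (λ d → r v + d ≤ r′ v) (point-self v _) (r≤r′ v Kv)))
                           (cap j r′ (step y z Ky Kz e (subst (w y z ≤_) (sym ([v]≔-off-v s j y≢v)) ok) R′))

  Capped-move-off-v : ∀ {s c y z} → K y → K z → Edge w y z → y ≢ v → z ≢ v → w y z ≤ s y →
                      Capped s c → Capped (move w s y z) c
  Capped-move-off-v {y = y} {z} Ky Kz e y≢v z≢v ok cap j r R =
    subst (λ m → m * A ≤ j * A + _) (trans (cong (r v +_) (point-≢ 1 λ v≡z → z≢v (sym v≡z))) (+-identityʳ (r v)))
      (Capped-K-move Ky Kz e y≢v ok cap j r R)

  Capped-move-into-v : ∀ {s c y} → K y → Edge w y v → y ≢ v → w y v ≤ s y →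
                       Capped s c → A ≤ c × Capped (move w s y v) (c ∸ A)
  Capped-move-into-v {s} {c} {y} Ky e y≢v ok cap = A≤c , cap′
    where
      gain : ∀ j r → Reach w K (move w s y v [v]≔ j) r → r v * A + A ≤ j * A + c
      gain j r R = subst (_≤ j * A + c) (trans (cong (λ m → (r v + m) * A) (point-self v 1)) (+1-*A (r v) A))
                     (Capped-K-move Ky Kv e y≢v ok cap j r R)
        where
          +1-*A : ∀ m A → (m + 1) * A ≡ m * A + A
          +1-*A = solve-∀
      A≤c : A ≤ c
      A≤c = subst (_≤ c) (cong (λ m → m * A + A) ([v]≔-at-v (move w s y v) 0 refl)) (gain 0 _ done)
      cap′ : Capped (move w s y v) (c ∸ A)
      cap′ j r R = +-cancelʳ-≤ A (r v * A) (j * A + (c ∸ A))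
        (≤-trans (gain j r R) (≤-reflexive (trans (cong (j * A +_) (sym (m∸n+n≡m A≤c))) (sym (+-assoc (j * A) (c ∸ A) A)))))

  Capped-move-out-of-v : ∀ {s c z} → K z → Edge w v z → z ≢ v → w v z ≤ s v →
                         Capped s c → Capped (move w s v z) (w v z * A + c)
  Capped-move-out-of-v {s} {c} {z} Kz e z≢v ok cap j r R with Reach-≤ (move w (s [v]≔ (j + w v z)) v z) same R
    where
      same : ∀ i → K i → (move w s v z [v]≔ j) i ≤ move w (s [v]≔ (j + w v z)) v z i
      same i Ki = ≤-reflexive ([ (λ { refl → at-v }) , off-v ]′ (toSum (i ≟ v)))
        where
          at-v : (move w s v z [v]≔ j) v ≡ move w (s [v]≔ (j + w v z)) v z v
          at-v = begin
            (move w s v z [v]≔ j) v                          ≡⟨ [v]≔-at-v (move w s v z) j refl ⟩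
            j                                                ≡⟨ m+n∸n≡m j (w v z) ⟨
            j + w v z ∸ w v z                                ≡⟨ +-identityʳ _ ⟨
            (j + w v z ∸ w v z) + 0                          ≡⟨ cong₂ (λ a b → (a ∸ w v z) + b) ([v]≔-at-v s _ refl) (point-≢ 1 λ v≡z → z≢v (sym v≡z)) ⟨
            ((s [v]≔ (j + w v z)) v ∸ w v z) + point z 1 v   ≡⟨ move-source w (s [v]≔ (j + w v z)) refl ⟨
            move w (s [v]≔ (j + w v z)) v z v                ∎
            where open ≡-Reasoning
          off-v : i ≢ v → (move w s v z [v]≔ j) i ≡ move w (s [v]≔ (j + w v z)) v z i
          off-v i≢v = trans ([v]≔-off-v (move w s v z) j i≢v) (move-cong w s {v} {z} {i} {p′ = s [v]≔ (j + w v z)} (sym ([v]≔-off-v s (j + w v z) i≢v)))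
  ... | r′ , R′ , r≤r′ = begin
    r v * A                       ≤⟨ *-monoˡ-≤ A (r≤r′ v Kv) ⟩
    r′ v * A                      ≤⟨ cap (j + w v z) r′ (step v z Kv Kz e (subst (w v z ≤_) (sym ([v]≔-at-v s _ refl)) (m≤n+m _ j)) R′) ⟩
    (j + w v z) * A + c           ≡⟨ cong (_+ c) (*-distribʳ-+ A j (w v z)) ⟩
    j * A + w v z * A + c         ≡⟨ +-assoc (j * A) _ c ⟩
    j * A + (w v z * A + c)       ∎
    where open ≤-Reasoning

  Capped-move-in-H : ∀ {s c y z} → H y → H z → Capped s c → Capped (move w s y z) c
  Capped-move-in-H {s} Hy Hz = Capped-≤ λ i Ki i≢v →
    ≤-reflexive (move-untouched w s (H-apart-K∖v Hy Ki i≢v ∘ sym) (H-apart-K∖v Hz Ki i≢v ∘ sym))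

  module _ {s : Dist n} {i : Fin n} (Hi : H i) where

    move-in-K-on-H : ∀ {y z} → K y → K z → y ≢ v → z ≢ v → move w s y z i ≡ s i
    move-in-K-on-H Ky Kz y≢v z≢v = move-untouched w s (H-apart-K∖v Hi Ky y≢v) (H-apart-K∖v Hi Kz z≢v)

    move-into-v-on-H : ∀ {y} → K y → y ≢ v → move w s y v i ≡ s i + point v 1 i
    move-into-v-on-H Ky y≢v = move-off-source w s (H-apart-K∖v Hi Ky y≢v)

    move-out-of-v-on-H : ∀ {z e} → K z → z ≢ v → w v z ≤ s v →
                         move w s v z i + point v (e + w v z) i ≡ s i + point v e i
    move-out-of-v-on-H {z} {e} Kz z≢v ok = [ (λ { refl → at-v }) , off-v ]′ (toSum (i ≟ v))
      where
        c = w v z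
        at-v : move w s v z v + point v (e + c) v ≡ s v + point v e v
        at-v = begin
          move w s v z v + point v (e + c) v  ≡⟨ cong₂ _+_ (move-source w s refl) (point-self v _) ⟩
          (s v ∸ c) + point z 1 v + (e + c)   ≡⟨ cong (λ m → (s v ∸ c) + m + (e + c)) (point-≢ 1 λ v≡z → z≢v (sym v≡z)) ⟩
          (s v ∸ c) + 0 + (e + c)             ≡⟨ rearrange (s v ∸ c) c e ⟩
          (s v ∸ c) + c + e                   ≡⟨ cong (_+ e) (m∸n+n≡m ok) ⟩
          s v + e                             ≡⟨ cong (s v +_) (point-self v e) ⟨
          s v + point v e v                   ∎
          where
            open ≡-Reasoning
            rearrange : ∀ a c e → a + 0 + (e + c) ≡ a + c + e
            rearrange = solve-∀
        off-v : i ≢ v → move w s v z i + point v (e + c) i ≡ s i + point v e i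
        off-v i≢v = cong₂ _+_ (move-untouched w s i≢v (H-apart-K∖v Hi Kz z≢v))
                              (trans (point-≢ _ i≢v) (sym (point-≢ _ i≢v)))

  -- G̃ replays the moves of G inside H and ignores those inside K, which only
  -- use up the potential Capped; when G brings a pebble to v, G̃ spends one of
  -- its e reserve pebbles on v or, if there are none, moves u → v.
  simulate-in-G̃ : ∀ {s r : Dist n} (t̃ : Dist (suc n)) e x → H x →
        (∀ i → H i → s i + point v e i ≤ t̃ (suc i)) → Capped s (e * A + t̃ zero) →
        Reach w AllV s r → 1 ≤ r x → TReachable W̃ H̃ t̃ (suc x) 1
  simulate-in-G̃ t̃ e x Hx ≤t̃ cap done 1≤ = t̃ , done , ≤-trans 1≤ (≤-trans (m≤m+n _ _) (≤t̃ x Hx))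
  simulate-in-G̃ {s} t̃ e x Hx ≤t̃ cap (step y z _ _ yz ok R) 1≤ with edge-side y z yz | y ≟ v | z ≟ v
  ... | inj₁ (Hy , Hz) | _ | _ =
    TReachable-pre (step (suc y) (suc z) Hy Hz yz (≤-trans ok (≤-trans (m≤m+n _ _) (≤t̃ y Hy))) done)
      (simulate-in-G̃ (move W̃ t̃ (suc y) (suc z)) e x Hx
         (λ i Hi → move-+-≤ w s {p′ = t̃ ∘ suc} (λ { refl → ok }) (≤t̃ i Hi))
         (Capped-weaken (≤-reflexive (cong (e * A +_) (sym (+-identityʳ _)))) (Capped-move-in-H Hy Hz cap)) R 1≤)
  ... | inj₂ _ | yes refl | yes refl = contradiction (subst (0 <_) (loopless _) yz) (<-irrefl refl)
  ... | inj₂ (Ky , Kz) | no y≢v | no z≢v =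
    simulate-in-G̃ t̃ e x Hx
      (λ i Hi → subst (λ m → m + point v e i ≤ t̃ (suc i)) (sym (move-in-K-on-H {s} Hi Ky Kz y≢v z≢v)) (≤t̃ i Hi))
      (Capped-move-off-v Ky Kz yz y≢v z≢v ok cap) R 1≤
  ... | inj₂ (Ky , Kz) | no y≢v | yes refl = into-v e ≤t̃ (Capped-move-into-v Ky yz y≢v ok cap)
    where
      s′ = move w s y v
      into-v : ∀ e → (∀ i → H i → s i + point v e i ≤ t̃ (suc i)) →
               A ≤ e * A + t̃ zero × Capped s′ (e * A + t̃ zero ∸ A) → TReachable W̃ H̃ t̃ (suc x) 1
      into-v (suc e) ≤t̃ (_ , cap′) =
        simulate-in-G̃ t̃ e x Hx ≤t̃′ (Capped-weaken (≤-reflexive (trans (cong (_∸ A) (+-assoc A (e * A) _)) (m+n∸m≡n A _))) cap′) R 1≤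
        where
          ≤t̃′ : ∀ i → H i → s′ i + point v e i ≤ t̃ (suc i)
          ≤t̃′ i Hi = begin
            s′ i + point v e i                   ≡⟨ cong (_+ point v e i) (move-into-v-on-H {s} Hi Ky y≢v) ⟩
            s i + point v 1 i + point v e i      ≡⟨ +-assoc (s i) _ _ ⟩
            s i + (point v 1 i + point v e i)    ≡⟨ cong (s i +_) (point-+ i 1 e) ⟨
            s i + point v (suc e) i              ≤⟨ ≤t̃ i Hi ⟩
            t̃ (suc i)                            ∎
            where open ≤-Reasoning
      into-v zero ≤t̃ (A≤u , cap′) =
        TReachable-pre (step zero (suc v) tt Hv edge-uv (subst (_≤ t̃ zero) (sym W̃-uv) A≤u) done)
          (simulate-in-G̃ (move W̃ t̃ zero (suc v)) 0 x Hx ≤t̃′ (Capped-weaken (≤-reflexive (sym (u→v-at-u t̃))) cap′) R 1≤)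
        where
          ≤t̃′ : ∀ i → H i → s′ i + point v 0 i ≤ t̃ (suc i) + point v 1 i
          ≤t̃′ i Hi = begin
            s′ i + point v 0 i                   ≡⟨ cong (_+ point v 0 i) (move-into-v-on-H {s} Hi Ky y≢v) ⟩
            s i + point v 1 i + point v 0 i      ≡⟨ +-swapʳ (s i) _ _ ⟩
            s i + point v 0 i + point v 1 i      ≤⟨ +-monoˡ-≤ (point v 1 i) (≤t̃ i Hi) ⟩
            t̃ (suc i) + point v 1 i              ∎
            where
              open ≤-Reasoning
              +-swapʳ : ∀ a b c → a + b + c ≡ a + c + b
              +-swapʳ = solve-∀
  ... | inj₂ (Ky , Kz) | yes refl | no z≢v =
    simulate-in-G̃ t̃ (e + w v z) x Hx
      (λ i Hi → subst (_≤ t̃ (suc i)) (sym (move-out-of-v-on-H {s} Hi Kz z≢v ok)) (≤t̃ i Hi))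
      (Capped-weaken (≤-reflexive (rearrange (w v z) e A (t̃ zero))) (Capped-move-out-of-v Kz yz z≢v ok cap)) R 1≤
    where
      rearrange : ∀ c e A t → c * A + (e * A + t) ≡ (e + c) * A + t
      rearrange = solve-∀

  G-reach⇒G̃-reach : ∀ {p̃ : Dist (suc n)} {q : Dist n} {x} → Supported H̃ p̃ → Supported K q → H x →
                    (∀ r → Reach w K q r → r v * A ≤ p̃ zero) →
                    TReachable w AllV (λ i → p̃ (suc i) + q i) x 1 → TReachable W̃ H̃ p̃ (suc x) 1
  G-reach⇒G̃-reach {p̃} {q} {x} supp-p̃ supp-q Hx bound (r , R , 1≤r) with push-u→v (q v) p̃ (bound q done)
  ... | t̃ , R̃ , u≤ , old≤ = TReachable-pre R̃ (simulate-in-G̃ t̃ 0 x Hx ≤t̃ cap R 1≤r)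
    where
      q-on-H : ∀ i → H i → q i ≤ point v (q v) i
      q-on-H i Hi = [ (λ { refl → ≤-reflexive (sym (point-self v _)) })
                    , (λ i≢v → ≤-reflexive (trans (supp-q i (λ Ki → i≢v (H∩K⊆v i Hi Ki))) (sym (point-≢ _ i≢v)))) ]′
                      (toSum (i ≟ v))
      ≤t̃ : ∀ i → H i → p̃ (suc i) + q i + point v 0 i ≤ t̃ (suc i)
      ≤t̃ i Hi = ≤-trans (≤-reflexive (trans (cong (p̃ (suc i) + q i +_) (point-0 v i)) (+-identityʳ _)))
                  (≤-trans (+-monoʳ-≤ (p̃ (suc i)) (q-on-H i Hi)) (old≤ i))
      cap : Capped (λ i → p̃ (suc i) + q i) (t̃ zero)
      cap = Capped-≤ (λ i Ki i≢v → ≤-reflexive (cong (_+ q i) (supp-p̃ (suc i) (λ Hi → i≢v (H∩K⊆v i Hi Ki)))))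
                     (Capped-intro (λ r R → ≤-trans (bound r R) (≤-trans u≤ (≤-reflexive (+-comm (t̃ zero) _)))))

  K-part : Dist n → Dist n
  K-part p i with cover i
  ... | inj₁ _ = 0
  ... | inj₂ _ = p i

  K-part-≤ : ∀ p i → K-part p i ≤ p i
  K-part-≤ p i with cover i
  ... | inj₁ _ = z≤n
  ... | inj₂ _ = ≤-refl

  K-part-supported : ∀ p → Supported K (K-part p)
  K-part-supported p i ¬Ki with cover i
  ... | inj₁ _  = refl
  ... | inj₂ Ki = ⊥-elim (¬Ki Ki)

  H-part-supported : ∀ p → Supported H (λ i → p i ∸ K-part p i)
  H-part-supported p i ¬Hi with cover i
  ... | inj₁ Hi = ⊥-elim (¬Hi Hi)
  ... | inj₂ _  = n∸n≡0 (p i)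

  LinearPebbling : ℕ → Set
  LinearPebbling B = ∀ t → 1 ≤ t → ∃ λ m → IsPebblingNumber w K v t m × m ≡ A * t + B

  module _ {B : ℕ} (πK : LinearPebbling B) where

    K-delivers : ∀ q t → Supported K q → t * A ≤ size q ∸ B → ∃ λ r → Reach w K q r × t ≤ r v
    K-delivers q zero    supp-q _     = q , done , z≤n
    K-delivers q (suc t) supp-q tA≤ = deliver (πK (suc t) (s≤s z≤n))
      where
        B≤ : B ≤ size q
        B≤ = <⇒≤ (m∸n≢0⇒n<m λ eq → 0≢1+n (sym (n≤0⇒n≡0 (≤-trans (m≤m+n 1 _) (subst (suc t * A ≤_) eq tA≤)))))
        deliver : (∃ λ m → IsPebblingNumber w K v (suc t) m × m ≡ A * suc t + B) → ∃ λ r → Reach w K q r × suc t ≤ r v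
        deliver (m , πt , m≡) = TReachable-≥-size Kv (proj₁ πt) q supp-q (begin
          m                 ≡⟨ m≡ ⟩
          A * suc t + B     ≡⟨ cong (_+ B) (*-comm A (suc t)) ⟩
          suc t * A + B     ≤⟨ +-monoˡ-≤ B tA≤ ⟩
          (size q ∸ B) + B  ≡⟨ m∸n+n≡m B≤ ⟩
          size q            ∎)
          where open ≤-Reasoning

    collapse-K : Dist n → Dist (suc n)
    collapse-K p zero    = size (K-part p) ∸ B
    collapse-K p (suc i) = p i ∸ K-part p i

    collapse-K-supported : ∀ p → Supported H̃ (collapse-K p)
    collapse-K-supported p zero    ¬⊤ = ⊥-elim (¬⊤ tt)
    collapse-K-supported p (suc i) ¬Hi = H-part-supported p i ¬Hi

    size-collapse-K : ∀ p → size p ≤ size (collapse-K p) + B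
    size-collapse-K p = begin
      size p                        ≡⟨ size-cong (λ i → m∸n+n≡m (K-part-≤ p i)) ⟨
      size (λ i → pH i + pK i)      ≡⟨ size-+ pH pK ⟩
      size pH + size pK             ≤⟨ +-monoʳ-≤ (size pH) (m≤n+m∸n (size pK) B) ⟩
      size pH + (B + (size pK ∸ B)) ≡⟨ rearrange (size pH) B (size pK ∸ B) ⟩
      (size pK ∸ B) + size pH + B   ∎
      where
        open ≤-Reasoning
        pK = K-part p
        pH = λ i → p i ∸ pK i
        rearrange : ∀ a b c → a + (b + c) ≡ c + a + b
        rearrange = solve-∀

    G-solvable-from-G̃ : ∀ {m₂} x → H x → (∀ p̃ → Supported H̃ p̃ → size p̃ ≡ m₂ → TReachable W̃ H̃ p̃ (suc x) 1) →
                 ∀ p → size p ≡ m₂ + B → TReachable w AllV p x 1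
    G-solvable-from-G̃ {m₂} x Hx solvable-G̃ p size-p = simulate
      (K-delivers (K-part p) t (K-part-supported p) (m/n*n≤m c A))
      (TReachable-≥-size Hx solvable-G̃ p̃ (collapse-K-supported p)
         (+-cancelʳ-≤ B m₂ (size p̃) (subst (_≤ size p̃ + B) size-p (size-collapse-K p))))
      where
        p̃ = collapse-K p
        c = p̃ zero
        t = c / A
        simulate : (∃ λ rK → Reach w K (K-part p) rK × t ≤ rK v) → TReachable W̃ H̃ p̃ (suc x) 1 →
                   TReachable w AllV p x 1
        simulate (rK , RK , t≤rK) (r̃ , R̃ , 1≤r̃) =
          let (r , R , ≤r) = Reach-surplus p (p̃ ∘ suc) (λ i _ → ≤-reflexive (m+[n∸m]≡n (K-part-≤ p i)))
                                           (Reach-⊆ (λ _ _ → tt) RK)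
          in TReachable-pre R (simulate-in-G r t x (λ i → ≤-trans (+-monoʳ-≤ (p̃ (suc i)) (point-≤ i λ { refl → t≤rK }))
                                                  (≤-trans (≤-reflexive (+-comm _ (rK i))) (≤r i tt)))
                                         (m<[1+m/n]*n c A) R̃ 1≤r̃)

    lift-unsolvable : ∀ {m₁} {p̃ : Dist (suc n)} x → H x → Supported H̃ p̃ → size p̃ ≤ m₁ → m₁ ≤ size p̃ + B →
                      ¬ TReachable W̃ H̃ p̃ (suc x) 1 → ∃ λ p → size p ≡ m₁ × ¬ TReachable w AllV p x 1
    lift-unsolvable {m₁} {p̃} x Hx supp-p̃ size≤ ≤size+B ¬reach̃ with πK (suc (p̃ zero / A)) (s≤s z≤n)
    ... | m , πt , m≡ with proj₂ πt (m₁ ∸ size (p̃ ∘ suc)) q-size<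
      where
        q-size< : m₁ ∸ size (p̃ ∘ suc) < m
        q-size< = begin-strict
          m₁ ∸ size (p̃ ∘ suc)  ≤⟨ m≤n+o⇒m∸n≤o m₁ (size (p̃ ∘ suc)) (≤-trans ≤size+B (≤-reflexive (rearrange (p̃ zero) _ B))) ⟩
          p̃ zero + B            <⟨ +-monoˡ-< B (m<[1+m/n]*n (p̃ zero) A) ⟩
          suc (p̃ zero / A) * A + B ≡⟨ cong (_+ B) (*-comm (suc (p̃ zero / A)) A) ⟩
          A * suc (p̃ zero / A) + B ≡⟨ m≡ ⟨
          m                     ∎
          where
            open ≤-Reasoning
            rearrange : ∀ a b c → a + b + c ≡ b + (a + c)
            rearrange = solve-∀
    ... | q , supp-q , size-q , ¬reach-q =
      (λ i → p̃ (suc i) + q i) , size-p , λ reach → ¬reach̃ (G-reach⇒G̃-reach supp-p̃ supp-q Hx bound reach)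
      where
        bound : ∀ r → Reach w K q r → r v * A ≤ p̃ zero
        bound r R = ≤-trans (*-monoˡ-≤ A (≤-pred (≰⇒> λ t<r → ¬reach-q (r , R , t<r)))) (m/n*n≤m (p̃ zero) A)
        size-p : size (λ i → p̃ (suc i) + q i) ≡ m₁
        size-p = trans (size-+ (p̃ ∘ suc) q)
                   (trans (cong (size (p̃ ∘ suc) +_) size-q) (m+[n∸m]≡n (≤-trans (m≤n+m _ (p̃ zero)) size≤)))

    π-G̃+B≤π-G : ∀ {m₁ m₂} x → H x → IsPebblingNumber w AllV x 1 m₁ → IsPebblingNumber W̃ H̃ (suc x) 1 m₂ →
            m₂ + B ≤ m₁
    π-G̃+B≤π-G {m₁} {m₂} x Hx π₁ π₂ = ≮⇒≥ λ m₁<m₂+B →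
      refute (proj₂ π₂ (m₁ ∸ B) (m∸o<n (IsPebblingNumber-positive {w = W̃} {S = H̃} {x = suc x} π₂) m₁<m₂+B))
      where
        refute : (∃ λ p̃ → Supported H̃ p̃ × size p̃ ≡ m₁ ∸ B × ¬ TReachable W̃ H̃ p̃ (suc x) 1) → ⊥
        refute (p̃ , supp-p̃ , size-p̃ , ¬reach̃) = solvable-in-G (lift-unsolvable x Hx supp-p̃ size≤ ≤size+B ¬reach̃)
          where
            size≤ : size p̃ ≤ m₁
            size≤ = subst (_≤ m₁) (sym size-p̃) (m∸n≤m m₁ B)
            ≤size+B : m₁ ≤ size p̃ + B
            ≤size+B = subst (λ k → m₁ ≤ k + B) (sym size-p̃) (subst (m₁ ≤_) (+-comm B (m₁ ∸ B)) (m≤n+m∸n m₁ B))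
            solvable-in-G : ¬ (∃ λ p → size p ≡ m₁ × ¬ TReachable w AllV p x 1)
            solvable-in-G (p , size-p , ¬reach) = ¬reach (proj₁ π₁ p (λ _ ¬⊤ → ⊥-elim (¬⊤ tt)) size-p)

    π-G≡π-G̃+B : ∀ {m₁ m₂} x → H x → IsPebblingNumber w AllV x 1 m₁ → IsPebblingNumber W̃ H̃ (suc x) 1 m₂ →
            m₁ ≡ m₂ + B
    π-G≡π-G̃+B {m₁} {m₂} x Hx π₁ π₂ = ≤-antisym (≮⇒≥ (refute ∘ proj₂ π₁ (m₂ + B))) (π-G̃+B≤π-G x Hx π₁ π₂)
      where
        refute : ¬ (∃ λ p → Supported AllV p × size p ≡ m₂ + B × ¬ TReachable w AllV p x 1)
        refute (p , _ , size-p , ¬reach) = ¬reach (G-solvable-from-G̃ x Hx (proj₁ π₂) p size-p)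

proposition4p1 : (n : ℕ) (w : Weights n) →
    (∀ i j → w i j ≡ w j i) → (∀ i → w i i ≡ 0) →
    ConnectedOn w AllV →
    (H K : VSet n) (v : Fin n) →
    (∀ i → H i ⊎ K i) →
    H v → K v → (∀ i → H i → K i → i ≡ v) →
    (∀ i j → Edge w i j → (H i × H j) ⊎ (K i × K j)) →
    ConnectedOn w H → ConnectedOn w K →
    CutVertex w v →
    (a b : ℤ) →
    (∀ (t : ℕ) → 1 ≤ t → ∃ λ m → IsPebblingNumber w K v t m × ℤ.+ m ≡ a ℤ.* ℤ.+ t ℤ.+ b) →
    (x : Fin n) → H x →
    ∀ m₁ m₂ →
    IsPebblingNumber w AllV x 1 m₁ →
    IsPebblingNumber (tildeW w v ℤ.∣ a ∣) (tildeV H) (suc x) 1 m₂ →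
    ℤ.+ m₁ ≡ ℤ.+ m₂ ℤ.+ b
proposition4p1 n w _ loopless _ H K v cover Hv Kv H∩K⊆v edge-side _ _ _ a b πK x Hx m₁ m₂ π₁ π₂
  with πK 1 (s≤s z≤n) | πK 2 (s≤s z≤n)
... | k₁ , πK₁ , k₁≡ | k₂ , πK₂ , k₂≡ with pebbling-coefficients a b Kv πK₁ πK₂ k₁≡ k₂≡
... | A′ , B , refl , refl = trans (cong ℤ.+_ (π-G≡π-G̃+B linear x Hx π₁ π₂)) (ℤ.pos-+ m₂ B)
  where
    open Gluing w loopless H K v cover Hv Kv H∩K⊆v edge-side A′
    linear : LinearPebbling B
    linear t 1≤t with πK t 1≤t
    ... | m , πt , m≡ = m , πt , ℤ.+-injective (begin
      ℤ.+ m                                ≡⟨ m≡ ⟩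
      ℤ.+ suc A′ ℤ.* ℤ.+ t ℤ.+ ℤ.+ B        ≡⟨ cong (ℤ._+ ℤ.+ B) (ℤ.pos-* (suc A′) t) ⟨
      ℤ.+ (suc A′ * t) ℤ.+ ℤ.+ B            ≡⟨ ℤ.pos-+ (suc A′ * t) B ⟨
      ℤ.+ (suc A′ * t + B)                  ∎)
      where open ≡-Reasoning
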